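{- Let a graph $G$ be factored into graphs $H$ and $K$, and let $u,v$ be vertices with $\deg_H(u)=\deg_H(v)=1$ and $u$ adjacent to $v$ in $H$. Let $C_K(u)$, $C_K(v)$ be the vertex sets of the connected components of $K$ containing $u$ and $v$ respectively. Then $U=C_K(u)\cup C_K(v)$ is alone, i.e. no vertex of $V(G)\setminus U$ has a neighbor in $U$ either in $G$ or in $H\oplus K$.
   Context: All graphs are finite, simple and undirected, and $G$ has no isolated vertices. For graphs $H,K$ on the vertex set $V(G)$, $G$ is factored into $H$ and $K$ if $A=BC$, where $A,B,C$ are the adjacency matrices of $G,H,K$ with respect to one common ordering of the vertices. $H\oplus K$ denotes the graph on $V(G)$ whose edge multiset is the disjoint union of $E(H)$ and $E(K)$. -}

module Defs where

open import Data.Nat using (ℕ; zero; suc; _+_; _*_)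
open import Data.Fin using (Fin; zero; suc)
open import Data.Bool using (Bool; true; false; T)
open import Data.Product using (Σ; ∃; _×_)
open import Data.Sum using (_⊎_)
open import Relation.Binary.PropositionalEquality using (_≡_)
open import Relation.Nullary using (¬_)

record Graph (n : ℕ) : Set where
  field
    adj   : Fin n → Fin n → Bool
    sym   : ∀ i j → adj i j ≡ adj j i
    loopless : ∀ i → adj i i ≡ false
open Graph public

Adj : ∀ {n} → Graph n → Fin n → Fin n → Set
Adj G i j = T (adj G i j)

∑ : ∀ n → (Fin n → ℕ) → ℕ
∑ zero    f = 0
∑ (suc n) f = f zero + ∑ n (λ i → f (suc i))

bit : Bool → ℕ
bit true  = 1
bit false = 0

AdjMat : ∀ {n} → Graph n → Fin n → Fin n → ℕ
AdjMat G i j = bit (adj G i j)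

_⊗_ : ∀ {n} → (Fin n → Fin n → ℕ) → (Fin n → Fin n → ℕ) → Fin n → Fin n → ℕ
_⊗_ {n} B C i j = ∑ n (λ k → B i k * C k j)

FactoredInto : ∀ {n} → Graph n → Graph n → Graph n → Set
FactoredInto G H K = ∀ i j → AdjMat G i j ≡ (AdjMat H ⊗ AdjMat K) i j

NoIsolated : ∀ {n} → Graph n → Set
NoIsolated {n} G = ∀ i → ∃ λ j → Adj G i j

deg : ∀ {n} → Graph n → Fin n → ℕ
deg {n} G u = ∑ n (λ j → AdjMat G u j)

data Reach {n} (K : Graph n) (u : Fin n) : Fin n → Set where
  here : Reach K u u
  step : ∀ {x y} → Reach K u x → Adj K x y → Reach K u y

InComponent : ∀ {n} → Graph n → Fin n → Fin n → Set
InComponent K u x = Reach K u x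

-- U is alone with respect to G and H ⊕ K: no vertex outside U has a
-- neighbour in U in G or in H ⊕ K (adjacent in H ⊕ K iff adjacent in H or in K).
Alone : ∀ {n} → Graph n → Graph n → Graph n → (Fin n → Set) → Set
Alone G H K U = ∀ x y → ¬ U x → U y →
  ¬ Adj G x y × ¬ (Adj H x y ⊎ Adj K x y)

-- Since A, B, C are symmetric, A = BC forces BC = (BC)ᵀ = CB: every K-edge followed
-- by an H-edge can be replaced by an H-edge followed by a K-edge with the same ends.
-- Hence if U is a union of K-components whose roots have all their H-neighbours in U,
-- pushing an H-edge back along a K-walk to the root shows that U is closed under H,
-- and then under G, whose edges are exactly the H-K paths. For U = C_K(u) ∪ C_K(v)
-- the roots u, v have the single H-neighbours v, u. A set closed under a symmetric
-- relation has no edge entering it from outside.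
module Submission where

open import Defs
open import Data.Nat using (ℕ; zero; suc; _+_; _*_; _≤_; _<_; z≤n; s≤s)
open import Data.Nat.Properties using (m≤m+n; m≤n+m; ≤-trans; <-≤-trans; <-irrefl; +-mono-≤; *-mono-≤)
open import Data.Fin using (Fin; zero; suc)
open import Data.Bool using (true; T)
open import Data.Empty using (⊥-elim)
open import Data.Product using (∃; _×_; _,_)
open import Data.Sum using (_⊎_; inj₁; inj₂; [_,_])
open import Relation.Binary.Definitions using (Symmetric; _Respects_)
open import Relation.Binary.PropositionalEquality using (_≡_; _≢_; refl; subst; cong)
  renaming (sym to ≡-sym)
open import Relation.Nullary using (¬_)
open import Relation.Unary using (Pred; _∪_)

f≤∑ : ∀ n (f : Fin n → ℕ) i → f i ≤ ∑ n f
f≤∑ (suc n) f zero    = m≤m+n _ _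
f≤∑ (suc n) f (suc i) = ≤-trans (f≤∑ n (λ i → f (suc i)) i) (m≤n+m _ _)

+-positive : ∀ m {n} → 0 < m + n → 0 < m ⊎ 0 < n
+-positive zero    p = inj₂ p
+-positive (suc m) p = inj₁ (s≤s z≤n)

∑-positive : ∀ n (f : Fin n → ℕ) → 0 < ∑ n f → ∃ λ k → 0 < f k
∑-positive (suc n) f p with +-positive (f zero) p
... | inj₁ p₀ = zero , p₀
... | inj₂ p′ with ∑-positive n (λ i → f (suc i)) p′
...   | k , pₖ = suc k , pₖ

both-positive⇒+≢1 : ∀ {m n} → 0 < m → 0 < n → m + n ≢ 1
both-positive⇒+≢1 p q e = <-irrefl refl (subst (2 ≤_) e (+-mono-≤ p q))

∑≡1⇒positive-unique : ∀ n (f : Fin n → ℕ) → ∑ n f ≡ 1 →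
                      ∀ {i j} → 0 < f i → 0 < f j → i ≡ j
∑≡1⇒positive-unique (suc n) f e {zero}  {zero}  p q = refl
∑≡1⇒positive-unique (suc n) f e {zero}  {suc j} p q =
  ⊥-elim (both-positive⇒+≢1 p (<-≤-trans q (f≤∑ n _ j)) e)
∑≡1⇒positive-unique (suc n) f e {suc i} {zero}  p q =
  ⊥-elim (both-positive⇒+≢1 q (<-≤-trans p (f≤∑ n _ i)) e)
∑≡1⇒positive-unique (suc n) f e {suc i} {suc j} p q with f zero
... | zero  = cong suc (∑≡1⇒positive-unique n (λ i → f (suc i)) e p q)
... | suc _ = ⊥-elim (both-positive⇒+≢1 (s≤s z≤n) (<-≤-trans p (f≤∑ n _ i)) e)

T⇒0<bit : ∀ {b} → T b → 0 < bit b
T⇒0<bit {true} _ = s≤s z≤n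

0<bit⇒T : ∀ {b} → 0 < bit b → T b
0<bit⇒T {true} _ = _

0<bit*bit⇒T×T : ∀ a b → 0 < bit a * bit b → T a × T b
0<bit*bit⇒T×T true true _ = _ , _

module _ {n : ℕ} where

  Adj-sym : (G : Graph n) → Symmetric (Adj G)
  Adj-sym G {a} {b} = subst T (sym G a b)

  0<⊗⇒path : ∀ (H K : Graph n) {a x} → 0 < (AdjMat H ⊗ AdjMat K) a x →
             ∃ λ m → Adj H a m × Adj K m x
  0<⊗⇒path H K p with ∑-positive n _ p
  ... | m , pₘ = m , 0<bit*bit⇒T×T _ _ pₘ

  path⇒0<⊗ : ∀ (H K : Graph n) {a m x} → Adj H a m → Adj K m x →
             0 < (AdjMat H ⊗ AdjMat K) a x
  path⇒0<⊗ H K {m = m} h k =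
    <-≤-trans (*-mono-≤ (T⇒0<bit h) (T⇒0<bit k)) (f≤∑ n _ m)

  deg≡1⇒neighbours-in : ∀ {ℓ} (H : Graph n) {P : Pred (Fin n) ℓ} {u v} →
                        deg H u ≡ 1 → Adj H u v → P v → ∀ {w} → Adj H u w → P w
  deg≡1⇒neighbours-in H {P} d h pᵥ h′ =
    subst P (∑≡1⇒positive-unique n _ d (T⇒0<bit h) (T⇒0<bit h′)) pᵥ

  Reach-∪-respects : ∀ (K : Graph n) u v → (Reach K u ∪ Reach K v) Respects Adj K
  Reach-∪-respects K u v k (inj₁ r) = inj₁ (step r k)
  Reach-∪-respects K u v k (inj₂ r) = inj₂ (step r k)

  respects⇒¬edge-into : ∀ {ℓ ℓ′} {R : Fin n → Fin n → Set ℓ} {U : Pred (Fin n) ℓ′} →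
                        U Respects R → Symmetric R →
                        ∀ x y → ¬ U x → U y → ¬ R x y
  respects⇒¬edge-into resp R-sym _ _ x∉U y∈U r = x∉U (resp (R-sym r) y∈U)

module Factorisation {n} (G H K : Graph n) (fac : FactoredInto G H K) where

  Adj⇒H-K-path : ∀ {a x} → Adj G a x → ∃ λ m → Adj H a m × Adj K m x
  Adj⇒H-K-path {a} {x} g = 0<⊗⇒path H K (subst (0 <_) (fac a x) (T⇒0<bit g))

  H-K-path⇒Adj : ∀ {a m x} → Adj H a m → Adj K m x → Adj G a x
  H-K-path⇒Adj {a} {x = x} h k =
    0<bit⇒T (subst (0 <_) (≡-sym (fac a x)) (path⇒0<⊗ H K h k))

  K-H-path⇒H-K-path : ∀ {a b x} → Adj K a b → Adj H b x → ∃ λ m → Adj H a m × Adj K m x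
  K-H-path⇒H-K-path k h =
    Adj⇒H-K-path (Adj-sym G (H-K-path⇒Adj (Adj-sym H h) (Adj-sym K k)))

  module _ {ℓ} {U : Pred (Fin n) ℓ} (resp-K : U Respects Adj K) where

    Reach-H-closed : ∀ {r} → (∀ {y} → Adj H r y → U y) →
                     ∀ {w x} → Reach K r w → Adj H w x → U x
    Reach-H-closed root here       h = root h
    Reach-H-closed root (step r k) h with K-H-path⇒H-K-path k h
    ... | m , hₘ , kₘ = resp-K kₘ (Reach-H-closed root r hₘ)

    respects-H⇒respects-G : U Respects Adj H → U Respects Adj G
    respects-H⇒respects-G resp-H g a∈U with Adj⇒H-K-path g
    ... | m , hₘ , kₘ = resp-K kₘ (resp-H hₘ a∈U)

  Reach-∪-respects-H : ∀ {u v} → deg H u ≡ 1 → deg H v ≡ 1 → Adj H u v →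
                       (Reach K u ∪ Reach K v) Respects Adj H
  Reach-∪-respects-H {u} {v} du dv huv h =
    [ (λ r → Reach-H-closed resp-K u-neighbours-in-U r h)
    , (λ r → Reach-H-closed resp-K v-neighbours-in-U r h) ]
    where
      U : Pred (Fin n) _
      U = Reach K u ∪ Reach K v
      resp-K : U Respects Adj K
      resp-K = Reach-∪-respects K u v
      u-neighbours-in-U : ∀ {w} → Adj H u w → U w
      u-neighbours-in-U = deg≡1⇒neighbours-in H {P = U} du huv (inj₂ here)
      v-neighbours-in-U : ∀ {w} → Adj H v w → U w
      v-neighbours-in-U = deg≡1⇒neighbours-in H {P = U} dv (Adj-sym H huv) (inj₁ here)

mainTheorem8 : ∀ {n} (G H K : Graph n) → NoIsolated G → FactoredInto G H K →
    (u v : Fin n) → deg H u ≡ 1 → deg H v ≡ 1 → Adj H u v →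
    Alone G H K (λ x → InComponent K u x ⊎ InComponent K v x)
mainTheorem8 G H K _ fac u v du dv huv x y x∉U y∈U =
    respects⇒¬edge-into resp-G (Adj-sym G) x y x∉U y∈U
  , [ respects⇒¬edge-into resp-H (Adj-sym H) x y x∉U y∈U
    , respects⇒¬edge-into resp-K (Adj-sym K) x y x∉U y∈U ]
  where
    open Factorisation G H K fac
    U : Pred (Fin _) _
    U = Reach K u ∪ Reach K v
    resp-K : U Respects Adj K
    resp-K = Reach-∪-respects K u v
    resp-H : U Respects Adj H
    resp-H = Reach-∪-respects-H du dv huv
    resp-G : U Respects Adj G
    resp-G = respects-H⇒respects-G resp-K resp-H
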